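{- Let $\beta\subseteq\alpha$ be compositions, let $n=|\alpha/\beta|$, and let $M\in\mathrm{SET}(\alpha/\beta)$. Then $M$ is a minimal element of the poset $\mathrm{SET}(\alpha/\beta)$ if and only if, for every $i=1,2,\ldots,n-1$, one of the following holds in $M$: (1) $i$ and $i+1$ are consecutive elements in the same row, i.e. they occupy adjacent cells of one row with $i$ immediately to the left of $i+1$; (2) $i$ and $i+1$ are consecutive elements in the same column, i.e. they lie in the same column with $i+1$ above $i$ and no cell of $\alpha/\beta$ between them; (3) $i$ lies in a row of $\alpha/\beta$ strictly higher than the row containing $i+1$.
   Context: A composition is a finite sequence $\alpha=(\alpha_1,\ldots,\alpha_k)$ of positive integers; $\ell(\alpha)=k$ and $|\alpha|=\sum_i\alpha_i$. Its diagram consists of $\alpha_i$ left-justified cells in row $i$, rows numbered from the bottom (row 1 is lowest), columns from the left. For compositions $\beta\subseteq\alpha$ (meaning $\ell(\beta)\le\ell(\alpha)$ and $\beta_j\le\alpha_j$ for $1\le j\le\ell(\beta)$), the skew diagram $\alpha/\beta$ is the set of cells of the diagram of $\alpha$ not in the diagram of $\beta$ (both diagrams placed with the same bottom-left corner), and $|\alpha/\beta|=|\alpha|-|\beta|$. A standard extended tableau of shape $\alpha/\beta$ is a bijective filling of the cells of $\alpha/\beta$ with $1,\ldots,n$ ($n=|\alpha/\beta|$) whose entries strictly increase from left to right along every row and from bottom to top along every column; $\mathrm{SET}(\alpha/\beta)$ is the set of these. For $1\le i\le n-1$ and $T\in\mathrm{SET}(\alpha/\beta)$, define $\pi_i(T)=T$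 if $i+1$ is in a strictly higher row than $i$; $\pi_i(T)=s_i(T)$ (the tableau obtained by swapping the entries $i$ and $i+1$) if $i+1$ is in a strictly lower row than $i$; and $\pi_i(T)=0$ if $i$ and $i+1$ are in the same row. Each $\pi_i$ maps $\mathrm{SET}(\alpha/\beta)$ into $\mathrm{SET}(\alpha/\beta)\cup\{0\}$. The poset structure on $\mathrm{SET}(\alpha/\beta)$: $S\le T$ iff $T$ is obtained from $S$ by applying a finite (possibly empty) sequence of operators $\pi_i$ with all intermediate results nonzero. -}

module Defs where

open import Data.Nat using (ℕ; zero; suc; _+_; _∸_; _≤_; _<_)
open import Data.Nat.Properties using (<-trans; n<1+n)
open import Data.List using (List; []; _∷_; length)
open import Data.Nat.ListAction using (sum)
open import Data.List.Relation.Unary.All using (All)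
open import Data.Fin using (Fin; toℕ; fromℕ<)
open import Data.Vec using (Vec; lookup; _[_]≔_)
open import Data.Product using (_×_; _,_; proj₁; proj₂; Σ; ∃)
open import Data.Sum using (_⊎_)
open import Data.Empty using (⊥)
open import Relation.Binary.PropositionalEquality using (_≡_)
open import Relation.Binary.Construct.Closure.ReflexiveTransitive using (Star)

IsComposition : List ℕ → Set
IsComposition α = All (λ a → 1 ≤ a) α

-- 0-based list lookup, returning 0 past the end.
at : List ℕ → ℕ → ℕ
at []       _       = 0
at (a ∷ as) zero    = a
at (a ∷ as) (suc j) = at as j

-- Length of row r (rows numbered from 1, bottom row is 1); 0 if r = 0 or r > ℓ.
rowLen : List ℕ → ℕ → ℕ
rowLen α zero    = 0
rowLen α (suc r) = at α r

_⊆c_ : List ℕ → List ℕ → Set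
β ⊆c α = (length β ≤ length α) × (∀ j → j < length β → at β j ≤ at α j)

skewSize : List ℕ → List ℕ → ℕ
skewSize α β = sum α ∸ sum β

-- A cell (row , column), both numbered from 1.
Cell : Set
Cell = ℕ × ℕ

row : Cell → ℕ
row = proj₁

col : Cell → ℕ
col = proj₂

InSkew : List ℕ → List ℕ → Cell → Set
InSkew α β (r , c) = (1 ≤ c) × (c ≤ rowLen α r) × (rowLen β r < c)

-- A filling of α/β by 1..n is represented by the vector T with
-- lookup T k = the cell containing the entry (toℕ k + 1).
Filling : List ℕ → List ℕ → Set
Filling α β = Vec Cell (skewSize α β)

IsSET : (α β : List ℕ) → Filling α β → Set
IsSET α β T =
  (∀ j k → lookup T j ≡ lookup T k → j ≡ k)
  × (∀ k → InSkew α β (lookup T k))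
  × (∀ x → InSkew α β x → ∃ λ k → lookup T k ≡ x)
  × (∀ j k → row (lookup T j) ≡ row (lookup T k)
           → col (lookup T j) < col (lookup T k) → toℕ j < toℕ k)
  × (∀ j k → col (lookup T j) ≡ col (lookup T k)
           → row (lookup T j) < row (lookup T k) → toℕ j < toℕ k)

swapEntries : ∀ {n} → Vec Cell n → Fin n → Fin n → Vec Cell n
swapEntries T a b = (T [ a ]≔ lookup T b) [ b ]≔ lookup T a

-- Positions of entries i+1 and i+2 (0-based index i), given i+2 ≤ n.
posA : ∀ {n} (i : ℕ) → suc i < n → Fin n
posA i p = fromℕ< (<-trans (n<1+n i) p)

posB : ∀ {n} (i : ℕ) → suc i < n → Fin n
posB i p = fromℕ< p

-- π_{i+1}(S) = T with T ≠ 0 (i is 0-based: the entries involved are i+1, i+2).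
--   entry i+2 strictly higher than i+1  : T = S
--   entry i+2 strictly lower than i+1   : T = s_{i+1}(S)
--   same row                            : result 0, no step.
PiStep : ∀ {n} (i : ℕ) → suc i < n → Vec Cell n → Vec Cell n → Set
PiStep i p S T =
  (row (lookup S (posA i p)) < row (lookup S (posB i p)) × T ≡ S)
  ⊎ (row (lookup S (posB i p)) < row (lookup S (posA i p))
       × T ≡ swapEntries S (posA i p) (posB i p))

Step : ∀ {n} → Vec Cell n → Vec Cell n → Set
Step {n} S T = Σ ℕ λ i → Σ (suc i < n) λ p → PiStep i p S T

-- S ≤ T in the poset SET(α/β): T is obtained from S by a finite sequence of
-- operators π_i with all intermediate results nonzero.
_≼_ : ∀ {n} → Vec Cell n → Vec Cell n → Set
S ≼ T = Star Step S T

IsMinimal : (α β : List ℕ) → Filling α β → Set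
IsMinimal α β M = IsSET α β M × (∀ S → IsSET α β S → S ≼ M → S ≡ M)

-- Conditions (1)–(3) on the entries i+1, i+2 (positions i, i+1) of M.
Cond : (α β : List ℕ) (M : Filling α β) (i : ℕ) → suc i < skewSize α β → Set
Cond α β M i p =
  let x = lookup M (posA i p)
      y = lookup M (posB i p)
  in
     (row x ≡ row y × suc (col x) ≡ col y)
     ⊎ (col x ≡ col y × row x < row y
          × (∀ z → InSkew α β z → col z ≡ col x → row x < row z → row z < row y → ⊥))
     ⊎ (row y < row x)

-- A nontrivial step π_i swaps i and i+1 when i+1 lies strictly lower, so its result has
-- i strictly below i+1 and, by column-strictness of the source, in a different column;
-- conditions (1)–(3) say precisely that M contains no such pair, so M has no strict
-- predecessor. Conversely, if i lies strictly below i+1 in another column of M, swapping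
-- them gives a standard tableau S ≠ M with π_i(S) = M. If i and i+1 share a row or a
-- column, any cell of α/β between them would carry an entry strictly between i and i+1.

module Submission where

open import Defs
open import Data.Nat using (ℕ; suc; _<_; _≤_; _≟_; s≤s; z≤n)
open import Data.Nat.Properties
  using (<-cmp; <-irrefl; <-asym; <-trans; ≤-trans; ≤∧≢⇒<; m<1+n⇒m≤n; n<1+n; <⇒≢; <⇒≱)
open import Data.List using (List)
open import Data.Product using (_×_; _,_; proj₁; proj₂; ∃; uncurry)
open import Data.Product.Properties using (×-≡,≡→≡)
open import Data.Sum using (inj₁; inj₂; _⊎_)
open import Data.Empty using (⊥; ⊥-elim)
open import Data.Fin using (Fin; toℕ)
open import Data.Fin.Properties using (toℕ-injective; toℕ-fromℕ<) renaming (_≟_ to _≟ᶠ_)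
open import Data.Fin.Permutation.Components using (transpose)
open import Data.Vec using (Vec; lookup; _[_]≔_)
open import Data.Vec.Properties using (lookup∘update; lookup∘update′; tabulate∘lookup; tabulate-cong)
open import Function using (_∘_)
open import Function.Bundles using (_⇔_; mk⇔)
open import Relation.Binary.PropositionalEquality
open import Relation.Binary.Definitions using (Tri; tri<; tri≈; tri>)
open import Relation.Binary.Construct.Closure.ReflexiveTransitive using (ε; _◅_)
open import Relation.Nullary using (¬_; yes; no)
open import Relation.Nullary.Decidable using (dec-true; dec-false)

lookup-extensionality : ∀ {A : Set} {n} {xs ys : Vec A n} →
                        (∀ k → lookup xs k ≡ lookup ys k) → xs ≡ ys
lookup-extensionality {xs = xs} {ys} eq =
  trans (sym (tabulate∘lookup xs)) (trans (tabulate-cong eq) (tabulate∘lookup ys))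

Increasing : ∀ {n} → (Cell → Cell → Set) → Vec Cell n → Set
Increasing R T = ∀ j k → R (lookup T j) (lookup T k) → toℕ j < toℕ k

LeftOf : Cell → Cell → Set
LeftOf x y = row x ≡ row y × col x < col y

Below : Cell → Cell → Set
Below x y = col x ≡ col y × row x < row y

module Adjacent {n} {a b : Fin n} (b≡1+a : toℕ b ≡ suc (toℕ a)) where

  a<b : toℕ a < toℕ b
  a<b = subst (toℕ a <_) (sym b≡1+a) (n<1+n (toℕ a))

  a≢b : a ≢ b
  a≢b a≡b = <⇒≢ a<b (cong toℕ a≡b)

  nothing-between : ∀ (k : Fin n) → toℕ a < toℕ k → toℕ k < toℕ b → ⊥
  nothing-between k a<k k<b = <⇒≱ a<k (m<1+n⇒m≤n (subst (toℕ k <_) b≡1+a k<b))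

  τ : Fin n → Fin n
  τ = transpose a b

  τa≡b : τ a ≡ b
  τa≡b rewrite dec-true (a ≟ᶠ a) refl = refl

  τb≡a : τ b ≡ a
  τb≡a rewrite dec-false (b ≟ᶠ a) (a≢b ∘ sym) | dec-true (b ≟ᶠ b) refl = refl

  τ-fixes : ∀ {k} → k ≢ a → k ≢ b → τ k ≡ k
  τ-fixes {k} k≢a k≢b rewrite dec-false (k ≟ᶠ a) k≢a | dec-false (k ≟ᶠ b) k≢b = refl

  data Position (k : Fin n) : Set where
    at-a      : k ≡ a → Position k
    at-b      : k ≡ b → Position k
    elsewhere : k ≢ a → k ≢ b → Position k

  position : ∀ k → Position k
  position k with k ≟ᶠ a | k ≟ᶠ b
  ... | yes k≡a | _       = at-a k≡a
  ... | no _    | yes k≡b = at-b k≡b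
  ... | no k≢a  | no k≢b  = elsewhere k≢a k≢b

  τ-involutive : ∀ k → τ (τ k) ≡ k
  τ-involutive k with position k
  ... | at-a refl         = trans (cong τ τa≡b) τb≡a
  ... | at-b refl         = trans (cong τ τb≡a) τa≡b
  ... | elsewhere k≢a k≢b = trans (cong τ (τ-fixes k≢a k≢b)) (τ-fixes k≢a k≢b)

  private
    subst-< : ∀ {j k j′ k′ : Fin n} → j ≡ j′ → k ≡ k′ → toℕ j < toℕ k → toℕ j′ < toℕ k′
    subst-< refl refl lt = lt

  τ-reflects-< : ∀ j k → toℕ (τ j) < toℕ (τ k) → toℕ j < toℕ k ⊎ (j ≡ b × k ≡ a)
  τ-reflects-< j k lt with position j | position k
  ... | at-a refl | at-a refl = ⊥-elim (<-irrefl refl lt)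
  ... | at-a refl | at-b refl = inj₁ a<b
  ... | at-a refl | elsewhere k≢a k≢b = inj₁ (<-trans a<b (subst-< τa≡b (τ-fixes k≢a k≢b) lt))
  ... | at-b refl | at-a refl = inj₂ (refl , refl)
  ... | at-b refl | at-b refl = ⊥-elim (<-irrefl refl lt)
  ... | at-b refl | elsewhere k≢a k≢b =
    inj₁ (≤∧≢⇒< (subst (_≤ toℕ k) (sym b≡1+a) (subst-< τb≡a (τ-fixes k≢a k≢b) lt))
                (k≢b ∘ toℕ-injective ∘ sym))
  ... | elsewhere j≢a j≢b | at-a refl =
    inj₁ (≤∧≢⇒< (m<1+n⇒m≤n (subst (toℕ j <_) b≡1+a (subst-< (τ-fixes j≢a j≢b) τa≡b lt)))
                (j≢a ∘ toℕ-injective))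
  ... | elsewhere j≢a j≢b | at-b refl = inj₁ (<-trans (subst-< (τ-fixes j≢a j≢b) τb≡a lt) a<b)
  ... | elsewhere j≢a j≢b | elsewhere k≢a k≢b = inj₁ (subst-< (τ-fixes j≢a j≢b) (τ-fixes k≢a k≢b) lt)

  lookup-swapEntries : ∀ (S : Vec Cell n) k → lookup (swapEntries S a b) k ≡ lookup S (τ k)
  lookup-swapEntries S k with position k
  ... | at-a refl = begin
    lookup (swapEntries S a b) a   ≡⟨ lookup∘update′ a≢b (S [ a ]≔ lookup S b) (lookup S a) ⟩
    lookup (S [ a ]≔ lookup S b) a ≡⟨ lookup∘update a S (lookup S b) ⟩
    lookup S b                     ≡⟨ cong (lookup S) τa≡b ⟨
    lookup S (τ a)                 ∎
    where open ≡-Reasoning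
  ... | at-b refl = begin
    lookup (swapEntries S a b) b ≡⟨ lookup∘update b (S [ a ]≔ lookup S b) (lookup S a) ⟩
    lookup S a                   ≡⟨ cong (lookup S) τb≡a ⟨
    lookup S (τ b)               ∎
    where open ≡-Reasoning
  ... | elsewhere k≢a k≢b = begin
    lookup (swapEntries S a b) k   ≡⟨ lookup∘update′ k≢b (S [ a ]≔ lookup S b) (lookup S a) ⟩
    lookup (S [ a ]≔ lookup S b) k ≡⟨ lookup∘update′ k≢a S (lookup S b) ⟩
    lookup S k                     ≡⟨ cong (lookup S) (τ-fixes k≢a k≢b) ⟨
    lookup S (τ k)                 ∎
    where open ≡-Reasoning

  lookup-swapEntries-a : ∀ (S : Vec Cell n) → lookup (swapEntries S a b) a ≡ lookup S b
  lookup-swapEntries-a S = trans (lookup-swapEntries S a) (cong (lookup S) τa≡b)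

  lookup-swapEntries-b : ∀ (S : Vec Cell n) → lookup (swapEntries S a b) b ≡ lookup S a
  lookup-swapEntries-b S = trans (lookup-swapEntries S b) (cong (lookup S) τb≡a)

  swapEntries-involutive : ∀ (S : Vec Cell n) → swapEntries (swapEntries S a b) a b ≡ S
  swapEntries-involutive S = lookup-extensionality λ k → begin
    lookup (swapEntries (swapEntries S a b) a b) k ≡⟨ lookup-swapEntries (swapEntries S a b) k ⟩
    lookup (swapEntries S a b) (τ k)              ≡⟨ lookup-swapEntries S (τ k) ⟩
    lookup S (τ (τ k))                            ≡⟨ cong (lookup S) (τ-involutive k) ⟩
    lookup S k                                    ∎
    where open ≡-Reasoning

  swapEntries-preserves-Increasing : ∀ (R : Cell → Cell → Set) (S : Vec Cell n) →
    Increasing R S → ¬ R (lookup S a) (lookup S b) → Increasing R (swapEntries S a b)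
  swapEntries-preserves-Increasing R S increasing ¬Rab j k Rjk
    with τ-reflects-< j k (increasing (τ j) (τ k) (subst₂ R (L j) (L k) Rjk))
    where L = lookup-swapEntries S
  ... | inj₁ j<k          = j<k
  ... | inj₂ (refl , refl) =
    ⊥-elim (¬Rab (subst₂ R (lookup-swapEntries-b S) (lookup-swapEntries-a S) Rjk))

module _ {α β : List ℕ} (T : Filling α β) (isSET : IsSET α β T) where

  entries-injective : ∀ j k → lookup T j ≡ lookup T k → j ≡ k
  entries-injective = proj₁ isSET

  entries-in-skew : ∀ k → InSkew α β (lookup T k)
  entries-in-skew = proj₁ (proj₂ isSET)

  every-cell-filled : ∀ x → InSkew α β x → ∃ λ k → lookup T k ≡ x
  every-cell-filled = proj₁ (proj₂ (proj₂ isSET))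

  rows-increase : Increasing LeftOf T
  rows-increase j k = uncurry (proj₁ (proj₂ (proj₂ (proj₂ isSET))) j k)

  columns-increase : Increasing Below T
  columns-increase j k = uncurry (proj₂ (proj₂ (proj₂ (proj₂ isSET))) j k)

swapEntries-preserves-IsSET : ∀ {α β} (S : Filling α β) {a b} → toℕ b ≡ suc (toℕ a) →
  IsSET α β S → row (lookup S a) ≢ row (lookup S b) → col (lookup S a) ≢ col (lookup S b) →
  IsSET α β (swapEntries S a b)
swapEntries-preserves-IsSET {α} {β} S {a} {b} b≡1+a isSET rows≢ cols≢ =
    injective′ , inSkew′ , onto′
  , (λ j k same-row cols< → rows-increase′ j k (same-row , cols<))
  , (λ j k same-col rows< → columns-increase′ j k (same-col , rows<))
  where
  open Adjacent b≡1+a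
  L = lookup-swapEntries S
  rows-increase′ : Increasing LeftOf (swapEntries S a b)
  rows-increase′ = swapEntries-preserves-Increasing LeftOf S (rows-increase S isSET) (rows≢ ∘ proj₁)
  columns-increase′ : Increasing Below (swapEntries S a b)
  columns-increase′ = swapEntries-preserves-Increasing Below S (columns-increase S isSET) (cols≢ ∘ proj₁)
  injective′ : ∀ j k → lookup (swapEntries S a b) j ≡ lookup (swapEntries S a b) k → j ≡ k
  injective′ j k eq = trans (sym (τ-involutive j))
    (trans (cong τ (entries-injective S isSET (τ j) (τ k) (trans (sym (L j)) (trans eq (L k))))) (τ-involutive k))
  inSkew′ : ∀ k → InSkew α β (lookup (swapEntries S a b) k)
  inSkew′ k = subst (InSkew α β) (sym (L k)) (entries-in-skew S isSET (τ k))
  onto′ : ∀ x → InSkew α β x → ∃ λ k → lookup (swapEntries S a b) k ≡ x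
  onto′ x x∈ with every-cell-filled S isSET x x∈
  ... | k , refl = τ k , trans (L (τ k)) (cong (lookup S) (τ-involutive k))

InSkew-row-interval : ∀ {α β} {x y : Cell} {c} → InSkew α β x → InSkew α β y →
  row x ≡ row y → col x < c → c ≤ col y → InSkew α β (row x , c)
InSkew-row-interval {x = r , _} {y = .r , _} (_ , _ , β<x) (_ , y≤α , _) refl x<c c≤y =
  ≤-trans (s≤s z≤n) x<c , ≤-trans c≤y y≤α , <-trans β<x x<c

module _ {α β : List ℕ} (T : Filling α β) (isSET : IsSET α β T)
         {a b : Fin (skewSize α β)} (b≡1+a : toℕ b ≡ suc (toℕ a)) where

  open Adjacent b≡1+a

  no-cell-between : ∀ (R : Cell → Cell → Set) → Increasing R T →
    ∀ z → InSkew α β z → R (lookup T a) z → R z (lookup T b) → ⊥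
  no-cell-between R increasing z z∈ Raz Rzb with every-cell-filled T isSET z z∈
  ... | k , refl = nothing-between k (increasing a k Raz) (increasing k b Rzb)

  consecutive-in-row-adjacent : row (lookup T a) ≡ row (lookup T b) →
    suc (col (lookup T a)) ≡ col (lookup T b)
  consecutive-in-row-adjacent same-row with <-cmp (col (lookup T a)) (col (lookup T b))
  ... | tri≈ _ same-col _ = ⊥-elim (a≢b (entries-injective T isSET a b (×-≡,≡→≡ (same-row , same-col))))
  ... | tri> _ _ b-left = ⊥-elim (<-asym a<b (rows-increase T isSET b a (sym same-row , b-left)))
  ... | tri< a-left _ _ with suc (col (lookup T a)) ≟ col (lookup T b)
  ...   | yes adjacent = adjacent
  ...   | no gap = ⊥-elim (no-cell-between LeftOf (rows-increase T isSET) _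
                     (InSkew-row-interval (entries-in-skew T isSET a) (entries-in-skew T isSET b)
                       same-row (n<1+n _) a-left)
                     (refl , n<1+n _) (same-row , ≤∧≢⇒< a-left gap))

  descent-columns-differ : row (lookup T b) < row (lookup T a) →
    col (lookup T a) ≢ col (lookup T b)
  descent-columns-differ b-lower same-col =
    <-asym a<b (columns-increase T isSET b a (sym same-col , b-lower))

toℕ-posB : ∀ {n} i (p : suc i < n) → toℕ (posB i p) ≡ suc (toℕ (posA i p))
toℕ-posB i p = trans (toℕ-fromℕ< p) (cong suc (sym (toℕ-fromℕ< _)))

module _ (α β : List ℕ) (i : ℕ) (p : suc i < skewSize α β) where

  private
    a b : Fin (skewSize α β)
    a = posA i p
    b = posB i p
    b≡1+a : toℕ b ≡ suc (toℕ a)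
    b≡1+a = toℕ-posB i p

  open Adjacent b≡1+a

  ascent-violates-Cond : ∀ (M : Filling α β) → row (lookup M a) < row (lookup M b) →
    col (lookup M a) ≢ col (lookup M b) → ¬ Cond α β M i p
  ascent-violates-Cond M up cols≢ (inj₁ (same-row , _))         = <⇒≢ up same-row
  ascent-violates-Cond M up cols≢ (inj₂ (inj₁ (same-col , _))) = cols≢ same-col
  ascent-violates-Cond M up cols≢ (inj₂ (inj₂ down))           = <-asym up down

  swapped-descent-violates-Cond : ∀ (S : Filling α β) → IsSET α β S →
    row (lookup S b) < row (lookup S a) → ¬ Cond α β (swapEntries S a b) i p
  swapped-descent-violates-Cond S isSET down = ascent-violates-Cond (swapEntries S a b)
    (subst₂ (λ x y → row x < row y) (sym (lookup-swapEntries-a S)) (sym (lookup-swapEntries-b S)) down)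
    (descent-columns-differ S isSET b≡1+a down ∘ sym
      ∘ subst₂ (λ x y → col x ≡ col y) (lookup-swapEntries-a S) (lookup-swapEntries-b S))

  ascent-is-not-minimal : ∀ (M : Filling α β) → IsMinimal α β M →
    row (lookup M a) < row (lookup M b) → col (lookup M a) ≢ col (lookup M b) → ⊥
  ascent-is-not-minimal M (isSET , minimal) up cols≢ = a≢b (entries-injective M isSET a b (sym Mb≡Ma))
    where
    S = swapEntries M a b
    step : Step S M
    step = i , p , inj₂
      ( subst₂ (λ x y → row x < row y) (sym (lookup-swapEntries-b M)) (sym (lookup-swapEntries-a M)) up
      , sym (swapEntries-involutive M))
    S≡M : S ≡ M
    S≡M = minimal S (swapEntries-preserves-IsSET M b≡1+a isSET (<⇒≢ up) cols≢) (step ◅ ε)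
    Mb≡Ma : lookup M b ≡ lookup M a
    Mb≡Ma = trans (sym (lookup-swapEntries-a M)) (cong (λ T → lookup T a) S≡M)

  minimal⇒Cond : ∀ (M : Filling α β) → IsMinimal α β M → Cond α β M i p
  minimal⇒Cond M minimal@(isSET , _) = classify (<-cmp (row (lookup M a)) (row (lookup M b)))
    where
    classify : Tri (row (lookup M a) < row (lookup M b)) (row (lookup M a) ≡ row (lookup M b))
                   (row (lookup M b) < row (lookup M a)) → Cond α β M i p
    classify (tri> _ _ down)     = inj₂ (inj₂ down)
    classify (tri≈ _ same-row _) = inj₁ (same-row , consecutive-in-row-adjacent M isSET b≡1+a same-row)
    classify (tri< up _ _) with col (lookup M a) ≟ col (lookup M b)
    ... | no cols≢     = ⊥-elim (ascent-is-not-minimal M minimal up cols≢)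
    ... | yes same-col = inj₂ (inj₁ (same-col , up , λ z z∈ z-col a-below-z z-below-b →
      no-cell-between M isSET b≡1+a Below (columns-increase M isSET) z z∈
        (sym z-col , a-below-z) (trans z-col same-col , z-below-b)))

Cond⇒minimal : ∀ {α β} (M : Filling α β) → (∀ i p → Cond α β M i p) →
  ∀ S → IsSET α β S → S ≼ M → S ≡ M
Cond⇒minimal M cond S isSET ε = refl
Cond⇒minimal M cond S isSET ((i , p , inj₁ (_ , refl)) ◅ steps) = Cond⇒minimal M cond S isSET steps
Cond⇒minimal {α} {β} M cond S isSET ((i , p , inj₂ (down , refl)) ◅ steps) =
  ⊥-elim (swapped-descent-violates-Cond α β i p S isSET down
           (subst (λ T → Cond α β T i p) (sym swap≡M) (cond i p)))
  where
  swap≡M : swapEntries S (posA i p) (posB i p) ≡ M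
  swap≡M = Cond⇒minimal M cond _
    (swapEntries-preserves-IsSET S (toℕ-posB i p) isSET (<⇒≢ down ∘ sym)
      (descent-columns-differ S isSET (toℕ-posB i p) down))
    steps

lemma11 : (α β : List ℕ) → IsComposition α → IsComposition β → β ⊆c α
    → (M : Filling α β) → IsSET α β M
    → IsMinimal α β M ⇔ (∀ i (p : suc i < skewSize α β) → Cond α β M i p)
lemma11 α β _ _ _ M isSET =
  mk⇔ (λ minimal i p → minimal⇒Cond α β i p M minimal) (λ cond → isSET , Cond⇒minimal M cond)
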